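{- For all $n\ge 3$ and $1\le k\le f_n-1$, \[ \big|A_n[1,k]\big|\cdot\big|A_n[k+1,f_n]\big| \le 4^{n-2}\,|A_n|. \]
   Context: Words are finite sequences over $\{0,1\}$; for sets of words $UV=\{uv:u\in U,v\in V\}$. For a word $w=w_1\cdots w_m$ and $1\le a\le b\le m$, $w[a,b]=w_a\cdots w_b$, and $W[a,b]=\{w[a,b]:w\in W\}$. Define $A_1=\{0\}$, $A_2=\{1\}$ and for $n\ge3$, $A_n=A_{n-1}A_{n-2}\cup A_{n-2}A_{n-1}$. All words of $A_n$ have common length $f_n$ (Fibonacci numbers, $f_1=f_2=1$, $f_n=f_{n-1}+f_{n-2}$). $|\cdot|$ denotes cardinality. -}

module Defs where

open import Data.Bool using (Bool; false; true)
open import Data.Bool.Properties using () renaming (_≟_ to _≟ᵇ_)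
open import Data.Nat using (ℕ; zero; suc; _+_)
open import Data.List using (List; []; _∷_; _++_; map; concatMap; take; drop; length; deduplicate)
open import Data.List.Properties using (≡-dec)
open import Relation.Binary.Definitions using (DecidableEquality)

-- Words over {0,1}: letter 0 is false, letter 1 is true.
Word : Set
Word = List Bool

_≟w_ : DecidableEquality Word
_≟w_ = ≡-dec _≟ᵇ_

-- Finite sets of words are represented by lists (duplicates allowed);
-- the cardinality of the represented set is the number of distinct entries.
card : List Word → ℕ
card W = length (deduplicate _≟w_ W)

_·_ : List Word → List Word → List Word
U · V = concatMap (λ u → map (λ v → u ++ v) V) U

-- A n for n ≥ 1 (A 0 is an unused junk value):
-- A₁ = {0}, A₂ = {1}, Aₙ = Aₙ₋₁Aₙ₋₂ ∪ Aₙ₋₂Aₙ₋₁.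
A : ℕ → List Word
A zero = []
A (suc zero) = (false ∷ []) ∷ []
A (suc (suc zero)) = (true ∷ []) ∷ []
A (suc (suc (suc n))) = (A (suc (suc n)) · A (suc n)) ++ (A (suc n) · A (suc (suc n)))

f : ℕ → ℕ
f zero = 0
f (suc zero) = 1
f (suc (suc n)) = f (suc n) + f n

-- W[a,b] = { w[a,b] : w ∈ W }, 1-based inclusive positions.
-- Specialised forms used: prefix w[1,k] = take k w,
-- suffix w[k+1,m] = drop k w (for m = length w).
prefixes : ℕ → List Word → List Word
prefixes k W = map (take k) W

suffixes : ℕ → List Word → List Word
suffixes k W = map (drop k) W

-- Write aₘ = |Aₘ| and Pₘ(k), Sₘ(k) for the numbers of prefixes and suffixes of length k of the
-- words of Aₘ. All words of Aᵢ have length fᵢ, so cutting Aₘ = Aₘ₋₁Aₘ₋₂ ∪ Aₘ₋₂Aₘ₋₁ at position k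
-- bounds Pₘ(k) and Sₘ(k) by the same counts one or two levels down, times the sizes of the blocks
-- lying wholly on one side of the cut; moreover aₘ₋₁aₘ₋₂ ≤ aₘ ≤ 2aₘ₋₁aₘ₋₂. Let the weight ℓₘ(k)
-- be the product of the aᵢ over the blocks of the greedy factorisation of Aₘ that fit into the
-- first k letters. A two-step induction proves Pₘ(k) ≤ 2^(m-2) ℓₘ(k) and Sₘ(k) ℓₘ(k) ≤ 2^(m-2) aₘ,
-- together with the analogous bounds for cuts inside the second block of the order Aₘ₋₂Aₘ₋₁;
-- multiplying the two bounds eliminates ℓₘ(k).

module Submission where

open import Defs
open import Data.Nat using (ℕ; zero; suc; _+_; _*_; _^_; _∸_; _≤_; _<_; z≤n; s≤s; _<?_; _≤?_; NonZero; >-nonZero)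
open import Data.Nat.Properties
open import Data.Bool using (if_then_else_)
open import Data.List using (List; []; _∷_; _++_; map; take; drop; length; deduplicate)
open import Data.List.Properties using (length-++; length-map; map-++; ++-cancelˡ; ∷-injective)
open import Data.List.Membership.Propositional using (_∈_)
open import Data.List.Membership.Propositional.Properties
  using (∈-∃++; ∈-++⁺ˡ; ∈-++⁺ʳ; ∈-++⁻; ∈-map⁺; ∈-map⁻; ∈-deduplicate⁺; ∈-deduplicate⁻)
open import Data.List.Relation.Binary.Subset.Propositional using (_⊆_)
open import Data.List.Relation.Unary.Any using (here; there)
open import Data.List.Relation.Unary.All as All using (All; []; _∷_)
import Data.List.Relation.Unary.All.Properties as All
open import Data.List.Relation.Unary.Unique.Propositional using (Unique; []; _∷_)
import Data.List.Relation.Unary.Unique.Propositional.Properties as Unique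
open import Data.List.Relation.Unary.Unique.DecPropositional.Properties _≟w_ using (deduplicate-!)
open import Data.Product using (∃-syntax; _×_; _,_)
open import Data.Sum using (inj₁; inj₂)
open import Data.Empty using (⊥-elim)
open import Relation.Nullary using (¬_; yes; no; does)
open import Relation.Nullary.Decidable using (dec-true; dec-false; True; toWitness)
open import Relation.Unary using (Decidable)
open import Relation.Binary.PropositionalEquality
open import Function using (_∘_)
open import Level using (Level)
open import Algebra.Properties.CommutativeSemigroup *-commutativeSemigroup
  using (x∙yz≈y∙xz; x∙yz≈xz∙y)

private
  variable
    ℓ₀ : Level
    X : Set ℓ₀

unique-length-≤ : {xs ys : List X} → Unique xs → xs ⊆ ys → length xs ≤ length ys
unique-length-≤ {xs = []} _ _ = z≤n
unique-length-≤ {xs = x ∷ xs} (x∉xs ∷ xs!) xs⊆ys with ∈-∃++ (xs⊆ys (here refl))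
... | ys₁ , ys₂ , refl = begin
    suc (length xs)                ≤⟨ s≤s (unique-length-≤ xs! xs⊆ys₁++ys₂) ⟩
    suc (length (ys₁ ++ ys₂))      ≡⟨ cong suc (length-++ ys₁) ⟩
    suc (length ys₁ + length ys₂)  ≡⟨ +-suc (length ys₁) (length ys₂) ⟨
    length ys₁ + suc (length ys₂)  ≡⟨ length-++ ys₁ ⟨
    length (ys₁ ++ x ∷ ys₂)        ∎
  where
    open ≤-Reasoning
    xs⊆ys₁++ys₂ : xs ⊆ ys₁ ++ ys₂
    xs⊆ys₁++ys₂ z∈xs with ∈-++⁻ ys₁ (xs⊆ys (there z∈xs))
    ... | inj₁ z∈ys₁ = ∈-++⁺ˡ z∈ys₁
    ... | inj₂ (here refl) = ⊥-elim (All.lookup x∉xs z∈xs refl)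
    ... | inj₂ (there z∈ys₂) = ∈-++⁺ʳ ys₁ z∈ys₂

++-injectiveˡ-length : (u u′ : List X) {v v′ : List X} → length u ≡ length u′ → u ++ v ≡ u′ ++ v′ → u ≡ u′
++-injectiveˡ-length [] [] _ _ = refl
++-injectiveˡ-length (x ∷ u) (x′ ∷ u′) |u|≡|u′| eq with ∷-injective eq
... | refl , eq′ = cong (x ∷_) (++-injectiveˡ-length u u′ (suc-injective |u|≡|u′|) eq′)

take-++-short : (k : ℕ) (u v : List X) → k ≤ length u → take k (u ++ v) ≡ take k u
take-++-short zero u v _ = refl
take-++-short (suc k) (x ∷ u) v (s≤s k≤|u|) = cong (x ∷_) (take-++-short k u v k≤|u|)

take-++-long : (u : List X) (j : ℕ) (v : List X) → take (length u + j) (u ++ v) ≡ u ++ take j v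
take-++-long [] j v = refl
take-++-long (x ∷ u) j v = cong (x ∷_) (take-++-long u j v)

drop-++-short : (k : ℕ) (u v : List X) → k ≤ length u → drop k (u ++ v) ≡ drop k u ++ v
drop-++-short zero u v _ = refl
drop-++-short (suc k) (x ∷ u) v (s≤s k≤|u|) = drop-++-short k u v k≤|u|

drop-++-long : (u : List X) (j : ℕ) (v : List X) → drop (length u + j) (u ++ v) ≡ drop j v
drop-++-long [] j v = refl
drop-++-long (x ∷ u) j v = drop-++-long u j v

m+n≤o+m⇒n≤o : ∀ m {n o} → m + n ≤ o + m → n ≤ o
m+n≤o+m⇒n≤o m {n} {o} le = +-cancelˡ-≤ m n o (subst (m + n ≤_) (+-comm o m) le)

data Cut (x : ℕ) : ℕ → Set where
  before : {k : ℕ} → k < x → Cut x k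
  from   : (j : ℕ) → Cut x (x + j)

cut : ∀ x k → Cut x k
cut x k with k <? x
... | yes k<x = before k<x
... | no k≮x = subst (Cut x) (m+[n∸m]≡n (≮⇒≥ k≮x)) (from (k ∸ x))

module _ where
  open ≤-Reasoning

  +-≤-double : ∀ {x y} c l → x ≤ c * l → y ≤ c * l → x + y ≤ 2 * c * l
  +-≤-double {x} {y} c l x≤ y≤ = begin
    x + y              ≤⟨ +-mono-≤ x≤ y≤ ⟩
    c * l + c * l      ≡⟨ cong (c * l +_) (+-identityʳ (c * l)) ⟨
    2 * (c * l)        ≡⟨ *-assoc 2 c l ⟨
    2 * c * l          ∎

  *-≤-double : ∀ c l → c * l ≤ 2 * c * l
  *-≤-double c l = *-monoˡ-≤ l (m≤m+n c _)

  *-≤-scale : ∀ {y} x c l → y ≤ c * l → x * y ≤ c * (x * l)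
  *-≤-scale {y} x c l y≤ = begin
    x * y        ≤⟨ *-monoʳ-≤ x y≤ ⟩
    x * (c * l)  ≡⟨ x∙yz≈y∙xz x c l ⟩
    c * (x * l)  ∎

  *-≤-merge : ∀ {y v} x u c l → y ≤ c * (u * l) → x * u ≤ v → x * y ≤ c * (v * l)
  *-≤-merge {y} {v} x u c l y≤ xu≤v = begin
    x * y              ≤⟨ *-≤-scale x c (u * l) y≤ ⟩
    c * (x * (u * l))  ≡⟨ cong (c *_) (*-assoc x u l) ⟨
    c * (x * u * l)    ≤⟨ *-monoʳ-≤ c (*-monoˡ-≤ l xu≤v) ⟩
    c * (v * l)        ∎

  *-≤-absorb : ∀ {b z} s l y c → s * l ≤ c * y → y * b ≤ z → s * (b * l) ≤ c * z
  *-≤-absorb {b} {z} s l y c sl≤ yb≤z = begin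
    s * (b * l)  ≡⟨ x∙yz≈xz∙y s b l ⟩
    s * l * b    ≤⟨ *-monoˡ-≤ b sl≤ ⟩
    c * y * b    ≡⟨ *-assoc c y b ⟩
    c * (y * b)  ≤⟨ *-monoʳ-≤ c yb≤z ⟩
    c * z        ∎

  *-≤-square : ∀ {x z w p} c l → x * x ≤ 2 * (z * w) → p ≤ c * l → x * (x * p) ≤ 2 * c * (z * (w * l))
  *-≤-square {x} {z} {w} {p} c l xx≤ p≤ = begin
    x * (x * p)                ≡⟨ *-assoc x x p ⟨
    x * x * p                  ≤⟨ *-mono-≤ xx≤ p≤ ⟩
    2 * (z * w) * (c * l)      ≡⟨ *-assoc 2 (z * w) (c * l) ⟩
    2 * (z * w * (c * l))      ≡⟨ cong (2 *_) (x∙yz≈y∙xz (z * w) c l) ⟩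
    2 * (c * (z * w * l))      ≡⟨ cong (λ t → 2 * (c * t)) (*-assoc z w l) ⟩
    2 * (c * (z * (w * l)))    ≡⟨ *-assoc 2 c _ ⟨
    2 * c * (z * (w * l))      ∎

  *-≤-square-cancel : ∀ {x z w u p} c l .{{_ : NonZero w}} →
    x * x ≤ 2 * (z * w) → w * p ≤ c * (u * l) → x * (x * p) ≤ 2 * c * (z * (u * l))
  *-≤-square-cancel {x} {z} {w} {u} {p} c l xx≤ wp≤ = *-cancelˡ-≤ w (begin
    w * (x * (x * p))            ≡⟨ x∙yz≈y∙xz w x (x * p) ⟩
    x * (w * (x * p))            ≡⟨ cong (x *_) (x∙yz≈y∙xz w x p) ⟩
    x * (x * (w * p))            ≤⟨ *-≤-square {x} {z} {w} c (u * l) xx≤ wp≤ ⟩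
    2 * c * (z * (w * (u * l)))  ≡⟨ cong (2 * c *_) (x∙yz≈y∙xz z w (u * l)) ⟩
    2 * c * (w * (z * (u * l)))  ≡⟨ x∙yz≈y∙xz (2 * c) w _ ⟩
    w * (2 * c * (z * (u * l)))  ∎)

  *-≤-product : ∀ {p s l b} c → p ≤ c * l → s * l ≤ c * b → p * s ≤ c * c * b
  *-≤-product {p} {s} {l} {b} c p≤ sl≤ = begin
    p * s          ≤⟨ *-monoˡ-≤ s p≤ ⟩
    c * l * s      ≡⟨ x∙yz≈xz∙y c s l ⟨
    c * (s * l)    ≤⟨ *-monoʳ-≤ c sl≤ ⟩
    c * (c * b)    ≡⟨ *-assoc c c b ⟨
    c * c * b      ∎

  *-distribˡ-≤ : ∀ x {y t₁ t₂} → y ≤ t₁ + t₂ → x * y ≤ x * t₁ + x * t₂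
  *-distribˡ-≤ x {t₁ = t₁} y≤ = ≤-trans (*-monoʳ-≤ x y≤) (≤-reflexive (*-distribˡ-+ x t₁ _))

  *-distribʳ-≤ : ∀ w s₁ s₂ {s} → s ≤ s₁ + s₂ → s * w ≤ s₁ * w + s₂ * w
  *-distribʳ-≤ w s₁ s₂ s≤ = ≤-trans (*-monoˡ-≤ w s≤) (≤-reflexive (*-distribʳ-+ w s₁ s₂))

private
  dedup : List Word → List Word
  dedup = deduplicate _≟w_

  ⊆-dedup : {W : List Word} → W ⊆ dedup W
  ⊆-dedup = ∈-deduplicate⁺ _≟w_

  dedup-⊆ : (W : List Word) → dedup W ⊆ W
  dedup-⊆ = ∈-deduplicate⁻ _≟w_

card-unique-≤ : {Z W : List Word} → Unique Z → Z ⊆ W → length Z ≤ card W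
card-unique-≤ Z! Z⊆W = unique-length-≤ Z! (⊆-dedup ∘ Z⊆W)

card-≤-length : (U : List Word) {W : List Word} → U ⊆ W → card U ≤ length W
card-≤-length U U⊆W = unique-length-≤ (deduplicate-! U) (U⊆W ∘ dedup-⊆ U)

card-mono : (U : List Word) {W : List Word} → U ⊆ W → card U ≤ card W
card-mono U U⊆W = card-unique-≤ (deduplicate-! U) (U⊆W ∘ dedup-⊆ U)

card-++ : (U V : List Word) → card (U ++ V) ≤ card U + card V
card-++ U V = ≤-trans (card-≤-length (U ++ V) U++V⊆) (≤-reflexive (length-++ (dedup U)))
  where
    U++V⊆ : U ++ V ⊆ dedup U ++ dedup V
    U++V⊆ w∈ with ∈-++⁻ U w∈
    ... | inj₁ w∈U = ∈-++⁺ˡ (⊆-dedup w∈U)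
    ... | inj₂ w∈V = ∈-++⁺ʳ (dedup U) (⊆-dedup w∈V)

AllOfLength : ℕ → List Word → Set
AllOfLength p = All (λ u → length u ≡ p)

AllOfLength-· : {p q : ℕ} (U V : List Word) → AllOfLength p U → AllOfLength q V → AllOfLength (p + q) (U · V)
AllOfLength-· [] V _ _ = []
AllOfLength-· (u ∷ U) V (|u| ∷ |U|) |V| = All.++⁺ (All.map⁺ (All.map (λ |v| → trans (length-++ u) (cong₂ _+_ |u| |v|)) |V|))
                                                   (AllOfLength-· U V |U| |V|)

∈-·⁺ : (U V : List Word) {u v : Word} → u ∈ U → v ∈ V → u ++ v ∈ U · V
∈-·⁺ (u ∷ U) V (here refl) v∈V = ∈-++⁺ˡ (∈-map⁺ (u ++_) v∈V)
∈-·⁺ (u ∷ U) V (there u∈U) v∈V = ∈-++⁺ʳ (map (u ++_) V) (∈-·⁺ U V u∈U v∈V)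

∈-·⁻ : (U V : List Word) {w : Word} → w ∈ U · V → ∃[ u ] ∃[ v ] u ∈ U × v ∈ V × w ≡ u ++ v
∈-·⁻ (u ∷ U) V w∈ with ∈-++⁻ (map (u ++_) V) w∈
... | inj₁ w∈uV with ∈-map⁻ (u ++_) w∈uV
...   | v , v∈V , refl = u , v , here refl , v∈V , refl
∈-·⁻ (u ∷ U) V w∈ | inj₂ w∈UV with ∈-·⁻ U V w∈UV
...   | u′ , v , u′∈U , v∈V , refl = u′ , v , there u′∈U , v∈V , refl

·-mono : (U V : List Word) {U′ V′ : List Word} → U ⊆ U′ → V ⊆ V′ → U · V ⊆ U′ · V′
·-mono U V {U′} {V′} U⊆U′ V⊆V′ w∈ with ∈-·⁻ U V w∈
... | u , v , u∈U , v∈V , refl = ∈-·⁺ U′ V′ (U⊆U′ u∈U) (V⊆V′ v∈V)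

length-· : (U V : List Word) → length (U · V) ≡ length U * length V
length-· [] V = refl
length-· (u ∷ U) V = begin
  length (map (u ++_) V ++ U · V)          ≡⟨ length-++ (map (u ++_) V) ⟩
  length (map (u ++_) V) + length (U · V)  ≡⟨ cong₂ _+_ (length-map (u ++_) V) (length-· U V) ⟩
  length V + length U * length V           ∎
  where open ≡-Reasoning

card-·-≤ : (U V : List Word) → card (U · V) ≤ card U * card V
card-·-≤ U V = ≤-trans (card-≤-length (U · V) (·-mono U V ⊆-dedup ⊆-dedup))
                       (≤-reflexive (length-· (dedup U) (dedup V)))

·-unique : {p : ℕ} {U V : List Word} → AllOfLength p U → Unique U → Unique V → Unique (U · V)
·-unique {U = []} _ _ _ = []
·-unique {p} {u ∷ U} {V} (|u| ∷ |U|) (u∉U ∷ U!) V! =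
  Unique.++⁺ (Unique.map⁺ (++-cancelˡ u _ _) V!) (·-unique |U| U! V!) disjoint
  where
    disjoint : ∀ {w} → ¬ (w ∈ map (u ++_) V × w ∈ U · V)
    disjoint (w∈uV , w∈UV) with ∈-map⁻ (u ++_) w∈uV | ∈-·⁻ U V w∈UV
    ... | v , _ , refl | u′ , v′ , u′∈U , _ , eq =
      All.lookup u∉U u′∈U (++-injectiveˡ-length u u′ (trans |u| (sym (All.lookup |U| u′∈U))) eq)

card-·-≥ : {p : ℕ} (U V : List Word) → AllOfLength p U → card U * card V ≤ card (U · V)
card-·-≥ U V |U| = begin
  card U * card V           ≡⟨ length-· (dedup U) (dedup V) ⟨
  length (dedup U · dedup V) ≤⟨ card-unique-≤ (·-unique (All.anti-mono (dedup-⊆ U) |U|)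
                                                (deduplicate-! U) (deduplicate-! V))
                                              (·-mono (dedup U) (dedup V) (dedup-⊆ U) (dedup-⊆ V)) ⟩
  card (U · V)              ∎
  where open ≤-Reasoning

module _ {p : ℕ} (U V : List Word) (|U| : AllOfLength p U) where

  card-prefixes-·-short : {k : ℕ} → k ≤ p → card (prefixes k (U · V)) ≤ card (prefixes k U)
  card-prefixes-·-short {k} k≤p = card-mono (prefixes k (U · V)) ⊆prefixes
    where
      ⊆prefixes : prefixes k (U · V) ⊆ prefixes k U
      ⊆prefixes w∈ with ∈-map⁻ (take k) w∈
      ... | w , w∈UV , refl with ∈-·⁻ U V w∈UV
      ... | u , v , u∈U , _ , refl
        rewrite take-++-short k u v (subst (k ≤_) (sym (All.lookup |U| u∈U)) k≤p) = ∈-map⁺ (take k) u∈U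

  card-prefixes-·-long : (j : ℕ) → card (prefixes (p + j) (U · V)) ≤ card U * card (prefixes j V)
  card-prefixes-·-long j = ≤-trans (card-mono (prefixes (p + j) (U · V)) ⊆U·prefixes) (card-·-≤ U (prefixes j V))
    where
      ⊆U·prefixes : prefixes (p + j) (U · V) ⊆ U · prefixes j V
      ⊆U·prefixes w∈ with ∈-map⁻ (take (p + j)) w∈
      ... | w , w∈UV , refl with ∈-·⁻ U V w∈UV
      ... | u , v , u∈U , v∈V , refl with All.lookup |U| u∈U
      ... | refl rewrite take-++-long u j v = ∈-·⁺ U (prefixes j V) u∈U (∈-map⁺ (take j) v∈V)

  card-suffixes-·-short : {k : ℕ} → k ≤ p → card (suffixes k (U · V)) ≤ card (suffixes k U) * card V
  card-suffixes-·-short {k} k≤p = ≤-trans (card-mono (suffixes k (U · V)) ⊆suffixes·V) (card-·-≤ (suffixes k U) V)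
    where
      ⊆suffixes·V : suffixes k (U · V) ⊆ suffixes k U · V
      ⊆suffixes·V w∈ with ∈-map⁻ (drop k) w∈
      ... | w , w∈UV , refl with ∈-·⁻ U V w∈UV
      ... | u , v , u∈U , v∈V , refl
        rewrite drop-++-short k u v (subst (k ≤_) (sym (All.lookup |U| u∈U)) k≤p) =
          ∈-·⁺ (suffixes k U) V (∈-map⁺ (drop k) u∈U) v∈V

  card-suffixes-·-long : (j : ℕ) → card (suffixes (p + j) (U · V)) ≤ card (suffixes j V)
  card-suffixes-·-long j = card-mono (suffixes (p + j) (U · V)) ⊆suffixes
    where
      ⊆suffixes : suffixes (p + j) (U · V) ⊆ suffixes j V
      ⊆suffixes w∈ with ∈-map⁻ (drop (p + j)) w∈
      ... | w , w∈UV , refl with ∈-·⁻ U V w∈UV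
      ... | u , v , u∈U , v∈V , refl with All.lookup |U| u∈U
      ... | refl rewrite drop-++-long u j v = ∈-map⁺ (drop j) v∈V

card-prefixes-++ : (k : ℕ) (U V : List Word) → card (prefixes k (U ++ V)) ≤ card (prefixes k U) + card (prefixes k V)
card-prefixes-++ k U V rewrite map-++ (take k) U V = card-++ (prefixes k U) (prefixes k V)

card-suffixes-++ : (k : ℕ) (U V : List Word) → card (suffixes k (U ++ V)) ≤ card (suffixes k U) + card (suffixes k V)
card-suffixes-++ k U V rewrite map-++ (drop k) U V = card-++ (suffixes k U) (suffixes k V)

A-length : ∀ m → AllOfLength (f m) (A m)
A-length zero = []
A-length (suc zero) = refl ∷ []
A-length (suc (suc zero)) = refl ∷ []
A-length (suc (suc (suc n))) =
  All.++⁺ (AllOfLength-· (A (2 + n)) (A (1 + n)) (A-length (suc (suc n))) (A-length (suc n)))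
          (subst (λ p → AllOfLength p (A (1 + n) · A (2 + n))) (+-comm (f (1 + n)) (f (2 + n)))
                 (AllOfLength-· (A (1 + n)) (A (2 + n)) (A-length (suc n)) (A-length (suc (suc n)))))

A-inhabited : ∀ n → ∃[ w ] w ∈ A (suc n)
A-inhabited zero = _ , here refl
A-inhabited (suc zero) = _ , here refl
A-inhabited (suc (suc n)) with A-inhabited (suc n) | A-inhabited n
... | u , u∈ | v , v∈ = u ++ v , ∈-++⁺ˡ (∈-·⁺ (A (2 + n)) (A (1 + n)) u∈ v∈)

-- Opaque so that unification treats these counts as atoms.
opaque
  a : ℕ → ℕ
  a m = card (A m)

  pre suf : ℕ → ℕ → ℕ
  pre m k = card (prefixes k (A m))
  suf m k = card (suffixes k (A m))

opaque
  unfolding a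
  a-nonZero : ∀ n → NonZero (a (suc n))
  a-nonZero n with A-inhabited n
  ... | w , w∈ = >-nonZero (card-mono (w ∷ []) λ { (here refl) → w∈ })

  a-≥-· : ∀ n → a (2 + n) * a (1 + n) ≤ a (3 + n)
  a-≥-· n = ≤-trans (card-·-≥ (A (2 + n)) (A (1 + n)) (A-length (2 + n)))
                    (card-mono (A (2 + n) · A (1 + n)) ∈-++⁺ˡ)

  a-≥-·′ : ∀ n → a (1 + n) * a (2 + n) ≤ a (3 + n)
  a-≥-·′ n = ≤-trans (card-·-≥ (A (1 + n)) (A (2 + n)) (A-length (1 + n)))
                     (card-mono (A (1 + n) · A (2 + n)) (∈-++⁺ʳ (A (2 + n) · A (1 + n))))

  a-≤-2· : ∀ n → a (3 + n) ≤ 2 * (a (2 + n) * a (1 + n))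
  a-≤-2· n = begin
    a (3 + n)                                  ≤⟨ card-++ (A (2 + n) · A (1 + n)) (A (1 + n) · A (2 + n)) ⟩
    card (A (2 + n) · A (1 + n)) + card (A (1 + n) · A (2 + n))
      ≤⟨ +-mono-≤ (card-·-≤ (A (2 + n)) (A (1 + n))) (card-·-≤ (A (1 + n)) (A (2 + n))) ⟩
    a (2 + n) * a (1 + n) + a (1 + n) * a (2 + n)  ≡⟨ cong (a (2 + n) * a (1 + n) +_) (*-comm (a (1 + n)) (a (2 + n))) ⟩
    a (2 + n) * a (1 + n) + a (2 + n) * a (1 + n)  ≡⟨ cong (a (2 + n) * a (1 + n) +_) (+-identityʳ _) ⟨
    2 * (a (2 + n) * a (1 + n))                    ∎
    where open ≤-Reasoning

a-square-≤ : ∀ n → a (3 + n) * a (3 + n) ≤ 2 * (a (4 + n) * a (1 + n))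
a-square-≤ n = begin
  a (3 + n) * a (3 + n)                    ≤⟨ *-monoʳ-≤ (a (3 + n)) (a-≤-2· n) ⟩
  a (3 + n) * (2 * (a (2 + n) * a (1 + n))) ≡⟨ x∙yz≈y∙xz (a (3 + n)) 2 _ ⟩
  2 * (a (3 + n) * (a (2 + n) * a (1 + n))) ≡⟨ cong (2 *_) (*-assoc (a (3 + n)) _ _) ⟨
  2 * (a (3 + n) * a (2 + n) * a (1 + n))   ≤⟨ *-monoʳ-≤ 2 (*-monoˡ-≤ (a (1 + n)) (a-≥-· (1 + n))) ⟩
  2 * (a (4 + n) * a (1 + n))               ∎
  where open ≤-Reasoning

module _ (n : ℕ) where
  f-+-assoc : (j : ℕ) → f (2 + n) + j ≡ f (1 + n) + (f n + j)
  f-+-assoc = +-assoc (f (1 + n)) (f n)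

  opaque
    unfolding a pre suf
    private
      A₂ A₁ : List Word
      A₂ = A (2 + n)
      A₁ = A (1 + n)

    pre-split-short : {k : ℕ} → k ≤ f (1 + n) → pre (3 + n) k ≤ pre (2 + n) k + pre (1 + n) k
    pre-split-short {k} k≤ = ≤-trans (card-prefixes-++ k (A₂ · A₁) (A₁ · A₂))
      (+-mono-≤ (card-prefixes-·-short A₂ A₁ (A-length (2 + n)) (≤-trans k≤ (m≤m+n _ _)))
                (card-prefixes-·-short A₁ A₂ (A-length (1 + n)) k≤))

    pre-split-middle : {j : ℕ} → j ≤ f n →
      pre (3 + n) (f (1 + n) + j) ≤ pre (2 + n) (f (1 + n) + j) + a (1 + n) * pre (2 + n) j
    pre-split-middle {j} j≤ = ≤-trans (card-prefixes-++ (f (1 + n) + j) (A₂ · A₁) (A₁ · A₂))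
      (+-mono-≤ (card-prefixes-·-short A₂ A₁ (A-length (2 + n)) (+-monoʳ-≤ (f (1 + n)) j≤))
                (card-prefixes-·-long A₁ A₂ (A-length (1 + n)) j))

    pre-split-long : (j : ℕ) →
      pre (3 + n) (f (2 + n) + j) ≤ a (2 + n) * pre (1 + n) j + a (1 + n) * pre (2 + n) (f n + j)
    pre-split-long j = ≤-trans (card-prefixes-++ (f (2 + n) + j) (A₂ · A₁) (A₁ · A₂))
      (+-mono-≤ (card-prefixes-·-long A₂ A₁ (A-length (2 + n)) j)
                (subst (λ k → card (prefixes k (A₁ · A₂)) ≤ a (1 + n) * pre (2 + n) (f n + j))
                       (sym (f-+-assoc j)) (card-prefixes-·-long A₁ A₂ (A-length (1 + n)) (f n + j))))

    suf-split-short : {k : ℕ} → k ≤ f (1 + n) →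
      suf (3 + n) k ≤ suf (2 + n) k * a (1 + n) + suf (1 + n) k * a (2 + n)
    suf-split-short {k} k≤ = ≤-trans (card-suffixes-++ k (A₂ · A₁) (A₁ · A₂))
      (+-mono-≤ (card-suffixes-·-short A₂ A₁ (A-length (2 + n)) (≤-trans k≤ (m≤m+n _ _)))
                (card-suffixes-·-short A₁ A₂ (A-length (1 + n)) k≤))

    suf-split-middle : {j : ℕ} → j ≤ f n →
      suf (3 + n) (f (1 + n) + j) ≤ suf (2 + n) (f (1 + n) + j) * a (1 + n) + suf (2 + n) j
    suf-split-middle {j} j≤ = ≤-trans (card-suffixes-++ (f (1 + n) + j) (A₂ · A₁) (A₁ · A₂))
      (+-mono-≤ (card-suffixes-·-short A₂ A₁ (A-length (2 + n)) (+-monoʳ-≤ (f (1 + n)) j≤))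
                (card-suffixes-·-long A₁ A₂ (A-length (1 + n)) j))

    suf-split-long : (j : ℕ) → suf (3 + n) (f (2 + n) + j) ≤ suf (1 + n) j + suf (2 + n) (f n + j)
    suf-split-long j = ≤-trans (card-suffixes-++ (f (2 + n) + j) (A₂ · A₁) (A₁ · A₂))
      (+-mono-≤ (card-suffixes-·-long A₂ A₁ (A-length (2 + n)) j)
                (subst (λ k → card (suffixes k (A₁ · A₂)) ≤ suf (2 + n) (f n + j))
                       (sym (f-+-assoc j)) (card-suffixes-·-long A₁ A₂ (A-length (1 + n)) (f n + j))))

f-≤-suc : ∀ m → f m ≤ f (suc m)
f-≤-suc zero = z≤n
f-≤-suc (suc m) = m≤m+n (f (suc m)) (f m)

-- ℓ m k is the product of the a i over the blocks A i that the greedy factorisation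
-- A m ⊇ A (m - 1) · A (m - 2), A (m - 1) ⊇ A (m - 2) · A (m - 3), … places entirely within the first k letters.
ℓ : ℕ → ℕ → ℕ
ℓ (suc (suc (suc n))) k =
  if does (k <? f (2 + n)) then ℓ (suc (suc n)) k else a (2 + n) * ℓ (suc n) (k ∸ f (2 + n))
ℓ _ _ = 1

ℓ-before : ∀ m {k} → k < f m → ℓ (suc m) k ≡ ℓ m k
ℓ-before (suc zero) _ = refl
ℓ-before (suc (suc n)) {k} k< rewrite dec-true (k <? f (2 + n)) k< = refl

ℓ-before₂ : ∀ m {k} → k < f m → ℓ (2 + m) k ≡ ℓ m k
ℓ-before₂ m k< = trans (ℓ-before (suc m) (<-≤-trans k< (f-≤-suc m))) (ℓ-before m k<)

ℓ-from : ∀ n j → ℓ (3 + n) (f (2 + n) + j) ≡ a (2 + n) * ℓ (1 + n) j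
ℓ-from n j rewrite dec-false (f (2 + n) + j <? f (2 + n)) (m+n≮m (f (2 + n)) j)
                 | m+n∸m≡n (f (2 + n)) j = refl

PrefixBound SuffixBound ShiftedPrefixBound ShiftedSuffixBound : ℕ → Set
PrefixBound m = ∀ k → k ≤ f m → pre m k ≤ 2 ^ (m ∸ 2) * ℓ m k
SuffixBound m = ∀ k → k ≤ f m → suf m k * ℓ m k ≤ 2 ^ (m ∸ 2) * a m
-- Cuts after the first block of the order A (m - 2) · A (m - 1): the factor a m / a (m - 1) ≥ a (m - 2)
-- accounts for that block. Without these bounds the induction does not close.
ShiftedPrefixBound m = ∀ j → j ≤ f (m ∸ 1) →
  a (m ∸ 1) * pre m (f (m ∸ 2) + j) ≤ 2 ^ (m ∸ 2) * (a m * ℓ (m ∸ 1) j)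
ShiftedSuffixBound m = ∀ j → j ≤ f (m ∸ 1) →
  suf m (f (m ∸ 2) + j) * ℓ (m ∸ 1) j ≤ 2 ^ (m ∸ 2) * a (m ∸ 1)

record Bounds (m : ℕ) : Set where
  field
    prefix         : PrefixBound m
    suffix         : SuffixBound m
    shifted-prefix : ShiftedPrefixBound m
    shifted-suffix : ShiftedSuffixBound m

module Step (n : ℕ) (b₁ : Bounds (4 + n)) (b₂ : Bounds (3 + n)) where
  open ≤-Reasoning
  open Bounds b₁ renaming (prefix to prefix₁; suffix to suffix₁; shifted-prefix to shifted-prefix₁; shifted-suffix to shifted-suffix₁)
  open Bounds b₂ renaming (prefix to prefix₂; suffix to suffix₂; shifted-prefix to shifted-prefix₂; shifted-suffix to shifted-suffix₂)

  prefix-short : ∀ k → k < f (3 + n) → pre (5 + n) k ≤ 2 ^ (3 + n) * ℓ (5 + n) k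
  prefix-short k k< = begin
    pre (5 + n) k                  ≤⟨ pre-split-short (2 + n) (<⇒≤ k<) ⟩
    pre (4 + n) k + pre (3 + n) k  ≤⟨ +-≤-double (2 ^ (2 + n)) _ (prefix₁ k k≤) second ⟩
    2 ^ (3 + n) * ℓ (4 + n) k      ≡⟨ cong (2 ^ (3 + n) *_) (ℓ-before (4 + n) (<-≤-trans k< (f-≤-suc (3 + n)))) ⟨
    2 ^ (3 + n) * ℓ (5 + n) k      ∎
    where
      k≤ : k ≤ f (4 + n)
      k≤ = ≤-trans (<⇒≤ k<) (f-≤-suc (3 + n))
      second : pre (3 + n) k ≤ 2 ^ (2 + n) * ℓ (4 + n) k
      second = begin
        pre (3 + n) k              ≤⟨ prefix₂ k (<⇒≤ k<) ⟩
        2 ^ (1 + n) * ℓ (3 + n) k  ≡⟨ cong (2 ^ (1 + n) *_) (ℓ-before (3 + n) k<) ⟨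
        2 ^ (1 + n) * ℓ (4 + n) k  ≤⟨ *-≤-double (2 ^ (1 + n)) _ ⟩
        2 ^ (2 + n) * ℓ (4 + n) k  ∎

  prefix-middle : ∀ i → f (3 + n) + i < f (4 + n) →
    pre (5 + n) (f (3 + n) + i) ≤ 2 ^ (3 + n) * ℓ (5 + n) (f (3 + n) + i)
  prefix-middle i k< = begin
    pre (5 + n) (f (3 + n) + i)
      ≤⟨ pre-split-middle (2 + n) (<⇒≤ i<) ⟩
    pre (4 + n) (f (3 + n) + i) + a (3 + n) * pre (4 + n) i
      ≤⟨ +-≤-double (2 ^ (2 + n)) _ first second ⟩
    2 ^ (3 + n) * (a (3 + n) * ℓ (2 + n) i)
      ≡⟨ cong (2 ^ (3 + n) *_) (trans (ℓ-before (4 + n) k<) (ℓ-from (1 + n) i)) ⟨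
    2 ^ (3 + n) * ℓ (5 + n) (f (3 + n) + i) ∎
    where
      i< : i < f (2 + n)
      i< = +-cancelˡ-< (f (3 + n)) _ _ k<
      first : pre (4 + n) (f (3 + n) + i) ≤ 2 ^ (2 + n) * (a (3 + n) * ℓ (2 + n) i)
      first = begin
        pre (4 + n) (f (3 + n) + i)             ≤⟨ prefix₁ _ (<⇒≤ k<) ⟩
        2 ^ (2 + n) * ℓ (4 + n) (f (3 + n) + i) ≡⟨ cong (2 ^ (2 + n) *_) (ℓ-from (1 + n) i) ⟩
        2 ^ (2 + n) * (a (3 + n) * ℓ (2 + n) i) ∎
      second : a (3 + n) * pre (4 + n) i ≤ 2 ^ (2 + n) * (a (3 + n) * ℓ (2 + n) i)
      second = *-≤-scale (a (3 + n)) (2 ^ (2 + n)) _ (begin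
        pre (4 + n) i              ≤⟨ prefix₁ i (≤-trans (<⇒≤ i<) (≤-trans (f-≤-suc (2 + n)) (f-≤-suc (3 + n)))) ⟩
        2 ^ (2 + n) * ℓ (4 + n) i  ≡⟨ cong (2 ^ (2 + n) *_) (ℓ-before₂ (2 + n) i<) ⟩
        2 ^ (2 + n) * ℓ (2 + n) i  ∎)

  prefix-long : ∀ k′ → k′ ≤ f (3 + n) → pre (5 + n) (f (4 + n) + k′) ≤ 2 ^ (3 + n) * ℓ (5 + n) (f (4 + n) + k′)
  prefix-long k′ k′≤ = begin
    pre (5 + n) (f (4 + n) + k′)
      ≤⟨ pre-split-long (2 + n) k′ ⟩
    a (4 + n) * pre (3 + n) k′ + a (3 + n) * pre (4 + n) (f (2 + n) + k′)
      ≤⟨ +-≤-double (2 ^ (2 + n)) _ (≤-trans first (*-≤-double (2 ^ (1 + n)) _)) (shifted-prefix₁ k′ k′≤) ⟩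
    2 ^ (3 + n) * (a (4 + n) * ℓ (3 + n) k′)
      ≡⟨ cong (2 ^ (3 + n) *_) (ℓ-from (2 + n) k′) ⟨
    2 ^ (3 + n) * ℓ (5 + n) (f (4 + n) + k′) ∎
    where
      first : a (4 + n) * pre (3 + n) k′ ≤ 2 ^ (1 + n) * (a (4 + n) * ℓ (3 + n) k′)
      first = *-≤-scale (a (4 + n)) (2 ^ (1 + n)) _ (prefix₂ k′ k′≤)

  prefix : PrefixBound (5 + n)
  prefix k k≤ with cut (f (4 + n)) k
  ... | from k′ = prefix-long k′ (+-cancelˡ-≤ (f (4 + n)) _ _ k≤)
  ... | before k< with cut (f (3 + n)) k
  ...   | before k<′ = prefix-short k k<′
  ...   | from i = prefix-middle i k<

  shifted-prefix-second : ∀ j → j ≤ f (4 + n) →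
    a (4 + n) * (a (3 + n) * pre (4 + n) j) ≤ 2 ^ (2 + n) * (a (5 + n) * ℓ (4 + n) j)
  shifted-prefix-second j j≤ =
    *-≤-merge (a (4 + n)) (a (3 + n)) (2 ^ (2 + n)) (ℓ (4 + n) j) (*-≤-scale (a (3 + n)) (2 ^ (2 + n)) _ (prefix₁ j j≤)) (a-≥-· (2 + n))

  shifted-prefix-first : ∀ v → v ≤ f (3 + n) →
    a (4 + n) * (a (4 + n) * pre (3 + n) v) ≤ 2 ^ (2 + n) * (a (5 + n) * ℓ (4 + n) (f (2 + n) + v))
  -- Two blocks A (4 + n) precede the cut; a-square-≤ trades them for the blocks A (5 + n) and
  -- A (2 + n) of the weight, at the price of the factor 2.
  shifted-prefix-first v v≤ with cut (f (1 + n)) v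
  ... | before v< = begin
      a (4 + n) * (a (4 + n) * pre (3 + n) v)
        ≤⟨ *-≤-square {a (4 + n)} {a (5 + n)} {a (2 + n)} (2 ^ (1 + n)) (ℓ (1 + n) v) (a-square-≤ (1 + n)) pre≤ ⟩
      2 ^ (2 + n) * (a (5 + n) * (a (2 + n) * ℓ (1 + n) v))
        ≡⟨ cong (λ w → 2 ^ (2 + n) * (a (5 + n) * w)) weight ⟨
      2 ^ (2 + n) * (a (5 + n) * ℓ (4 + n) (f (2 + n) + v)) ∎
    where
      pre≤ : pre (3 + n) v ≤ 2 ^ (1 + n) * ℓ (1 + n) v
      pre≤ = ≤-trans (prefix₂ v v≤) (≤-reflexive (cong (2 ^ (1 + n) *_) (ℓ-before₂ (1 + n) v<)))
      weight : ℓ (4 + n) (f (2 + n) + v) ≡ a (2 + n) * ℓ (1 + n) v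
      weight = trans (ℓ-before (3 + n) (+-monoʳ-< (f (2 + n)) v<)) (ℓ-from n v)
  ... | from u = begin
      a (4 + n) * (a (4 + n) * pre (3 + n) (f (1 + n) + u))
        ≤⟨ *-≤-square-cancel {a (4 + n)} {a (5 + n)} {a (2 + n)} {a (3 + n)} (2 ^ (1 + n)) (ℓ (2 + n) u)
             {{a-nonZero (1 + n)}} (a-square-≤ (1 + n)) (shifted-prefix₂ u (m+n≤o+m⇒n≤o (f (1 + n)) v≤)) ⟩
      2 ^ (2 + n) * (a (5 + n) * (a (3 + n) * ℓ (2 + n) u))
        ≡⟨ cong (λ w → 2 ^ (2 + n) * (a (5 + n) * w)) weight ⟨
      2 ^ (2 + n) * (a (5 + n) * ℓ (4 + n) (f (2 + n) + (f (1 + n) + u))) ∎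
    where
      weight : ℓ (4 + n) (f (2 + n) + (f (1 + n) + u)) ≡ a (3 + n) * ℓ (2 + n) u
      weight = trans (cong (ℓ (4 + n)) (sym (f-+-assoc (1 + n) u))) (ℓ-from (1 + n) u)

  shifted-prefix : ShiftedPrefixBound (5 + n)
  shifted-prefix j j≤ with cut (f (2 + n)) j
  ... | before j< = begin
      a (4 + n) * pre (5 + n) (f (3 + n) + j)
        ≤⟨ *-distribˡ-≤ (a (4 + n)) (pre-split-middle (2 + n) (<⇒≤ j<)) ⟩
      a (4 + n) * pre (4 + n) (f (3 + n) + j) + a (4 + n) * (a (3 + n) * pre (4 + n) j)
        ≤⟨ +-≤-double (2 ^ (2 + n)) _ first (shifted-prefix-second j j≤) ⟩
      2 ^ (3 + n) * (a (5 + n) * ℓ (4 + n) j) ∎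
    where
      weight : ℓ (4 + n) (f (3 + n) + j) ≡ a (3 + n) * ℓ (4 + n) j
      weight = trans (ℓ-from (1 + n) j) (cong (a (3 + n) *_) (sym (ℓ-before₂ (2 + n) j<)))
      first : a (4 + n) * pre (4 + n) (f (3 + n) + j) ≤ 2 ^ (2 + n) * (a (5 + n) * ℓ (4 + n) j)
      first = *-≤-merge (a (4 + n)) (a (3 + n)) (2 ^ (2 + n)) (ℓ (4 + n) j)
        (≤-trans (prefix₁ _ (+-monoʳ-≤ (f (3 + n)) (<⇒≤ j<))) (≤-reflexive (cong (2 ^ (2 + n) *_) weight)))
        (a-≥-· (2 + n))
  ... | from v = begin
      a (4 + n) * pre (5 + n) (f (3 + n) + (f (2 + n) + v))
        ≡⟨ cong (λ k → a (4 + n) * pre (5 + n) k) (f-+-assoc (2 + n) v) ⟨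
      a (4 + n) * pre (5 + n) (f (4 + n) + v)
        ≤⟨ *-distribˡ-≤ (a (4 + n)) (pre-split-long (2 + n) v) ⟩
      a (4 + n) * (a (4 + n) * pre (3 + n) v) + a (4 + n) * (a (3 + n) * pre (4 + n) (f (2 + n) + v))
        ≤⟨ +-≤-double (2 ^ (2 + n)) _ (shifted-prefix-first v (m+n≤o+m⇒n≤o (f (2 + n)) j≤))
                                      (shifted-prefix-second _ j≤) ⟩
      2 ^ (3 + n) * (a (5 + n) * ℓ (4 + n) (f (2 + n) + v)) ∎

  suffix-first : ∀ k → k ≤ f (4 + n) → suf (4 + n) k * a (3 + n) * ℓ (4 + n) k ≤ 2 ^ (2 + n) * a (5 + n)
  suffix-first k k≤ = ≤-trans (≤-reflexive (*-assoc (suf (4 + n) k) _ _))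
    (*-≤-absorb (suf (4 + n) k) (ℓ (4 + n) k) (a (4 + n)) (2 ^ (2 + n)) (suffix₁ k k≤) (a-≥-· (2 + n)))

  suffix-short : ∀ k → k < f (3 + n) → suf (5 + n) k * ℓ (5 + n) k ≤ 2 ^ (3 + n) * a (5 + n)
  suffix-short k k< = begin
    suf (5 + n) k * ℓ (5 + n) k
      ≡⟨ cong (suf (5 + n) k *_) (ℓ-before (4 + n) (<-≤-trans k< (f-≤-suc (3 + n)))) ⟩
    suf (5 + n) k * ℓ (4 + n) k
      ≤⟨ *-distribʳ-≤ _ (suf (4 + n) k * a (3 + n)) (suf (3 + n) k * a (4 + n)) (suf-split-short (2 + n) (<⇒≤ k<)) ⟩
    suf (4 + n) k * a (3 + n) * ℓ (4 + n) k + suf (3 + n) k * a (4 + n) * ℓ (4 + n) k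
      ≤⟨ +-≤-double (2 ^ (2 + n)) (a (5 + n)) (suffix-first k (≤-trans (<⇒≤ k<) (f-≤-suc (3 + n))))
                                              (≤-trans second (*-≤-double (2 ^ (1 + n)) _)) ⟩
    2 ^ (3 + n) * a (5 + n) ∎
    where
      second : suf (3 + n) k * a (4 + n) * ℓ (4 + n) k ≤ 2 ^ (1 + n) * a (5 + n)
      second = begin
        suf (3 + n) k * a (4 + n) * ℓ (4 + n) k    ≡⟨ *-assoc (suf (3 + n) k) _ _ ⟩
        suf (3 + n) k * (a (4 + n) * ℓ (4 + n) k)  ≡⟨ cong (λ w → suf (3 + n) k * (a (4 + n) * w)) (ℓ-before (3 + n) k<) ⟩
        suf (3 + n) k * (a (4 + n) * ℓ (3 + n) k)
          ≤⟨ *-≤-absorb (suf (3 + n) k) (ℓ (3 + n) k) (a (3 + n)) (2 ^ (1 + n)) (suffix₂ k (<⇒≤ k<)) (a-≥-·′ (2 + n)) ⟩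
        2 ^ (1 + n) * a (5 + n)                     ∎

  suffix-middle : ∀ i → f (3 + n) + i < f (4 + n) →
    suf (5 + n) (f (3 + n) + i) * ℓ (5 + n) (f (3 + n) + i) ≤ 2 ^ (3 + n) * a (5 + n)
  suffix-middle i k< = begin
    suf (5 + n) (f (3 + n) + i) * ℓ (5 + n) (f (3 + n) + i)
      ≡⟨ cong (suf (5 + n) (f (3 + n) + i) *_) (ℓ-before (4 + n) k<) ⟩
    suf (5 + n) (f (3 + n) + i) * ℓ (4 + n) (f (3 + n) + i)
      ≤⟨ *-distribʳ-≤ _ (suf (4 + n) (f (3 + n) + i) * a (3 + n)) (suf (4 + n) i) (suf-split-middle (2 + n) (<⇒≤ i<)) ⟩
    suf (4 + n) (f (3 + n) + i) * a (3 + n) * ℓ (4 + n) (f (3 + n) + i) + suf (4 + n) i * ℓ (4 + n) (f (3 + n) + i)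
      ≤⟨ +-≤-double (2 ^ (2 + n)) (a (5 + n)) (suffix-first _ (<⇒≤ k<)) second ⟩
    2 ^ (3 + n) * a (5 + n) ∎
    where
      i< : i < f (2 + n)
      i< = +-cancelˡ-< (f (3 + n)) _ _ k<
      i≤ : i ≤ f (4 + n)
      i≤ = ≤-trans (<⇒≤ i<) (≤-trans (f-≤-suc (2 + n)) (f-≤-suc (3 + n)))
      second : suf (4 + n) i * ℓ (4 + n) (f (3 + n) + i) ≤ 2 ^ (2 + n) * a (5 + n)
      second = begin
        suf (4 + n) i * ℓ (4 + n) (f (3 + n) + i)  ≡⟨ cong (suf (4 + n) i *_) (ℓ-from (1 + n) i) ⟩
        suf (4 + n) i * (a (3 + n) * ℓ (2 + n) i)  ≡⟨ cong (λ w → suf (4 + n) i * (a (3 + n) * w)) (ℓ-before₂ (2 + n) i<) ⟨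
        suf (4 + n) i * (a (3 + n) * ℓ (4 + n) i)
          ≤⟨ *-≤-absorb (suf (4 + n) i) (ℓ (4 + n) i) (a (4 + n)) (2 ^ (2 + n)) (suffix₁ i i≤) (a-≥-· (2 + n)) ⟩
        2 ^ (2 + n) * a (5 + n)                     ∎

  suffix-long : ∀ k′ → k′ ≤ f (3 + n) →
    suf (5 + n) (f (4 + n) + k′) * ℓ (5 + n) (f (4 + n) + k′) ≤ 2 ^ (3 + n) * a (5 + n)
  suffix-long k′ k′≤ = begin
    suf (5 + n) (f (4 + n) + k′) * ℓ (5 + n) (f (4 + n) + k′)
      ≡⟨ cong (suf (5 + n) (f (4 + n) + k′) *_) (ℓ-from (2 + n) k′) ⟩
    suf (5 + n) (f (4 + n) + k′) * w
      ≤⟨ *-distribʳ-≤ w (suf (3 + n) k′) (suf (4 + n) (f (2 + n) + k′)) (suf-split-long (2 + n) k′) ⟩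
    suf (3 + n) k′ * w + suf (4 + n) (f (2 + n) + k′) * w
      ≤⟨ +-≤-double (2 ^ (2 + n)) (a (5 + n)) (≤-trans first (*-≤-double (2 ^ (1 + n)) _)) second ⟩
    2 ^ (3 + n) * a (5 + n) ∎
    where
      w : ℕ
      w = a (4 + n) * ℓ (3 + n) k′
      first : suf (3 + n) k′ * w ≤ 2 ^ (1 + n) * a (5 + n)
      first = *-≤-absorb (suf (3 + n) k′) (ℓ (3 + n) k′) (a (3 + n)) (2 ^ (1 + n)) (suffix₂ k′ k′≤) (a-≥-·′ (2 + n))
      second : suf (4 + n) (f (2 + n) + k′) * w ≤ 2 ^ (2 + n) * a (5 + n)
      second = *-≤-absorb (suf (4 + n) (f (2 + n) + k′)) (ℓ (3 + n) k′) (a (3 + n)) (2 ^ (2 + n))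
                          (shifted-suffix₁ k′ k′≤) (a-≥-·′ (2 + n))

  suffix : SuffixBound (5 + n)
  suffix k k≤ with cut (f (4 + n)) k
  ... | from k′ = suffix-long k′ (+-cancelˡ-≤ (f (4 + n)) _ _ k≤)
  ... | before k< with cut (f (3 + n)) k
  ...   | before k<′ = suffix-short k k<′
  ...   | from i = suffix-middle i k<

  shifted-suffix-first : ∀ v → v ≤ f (3 + n) →
    suf (3 + n) v * ℓ (4 + n) (f (2 + n) + v) ≤ 2 ^ (1 + n) * a (4 + n)
  shifted-suffix-first v v≤ with cut (f (1 + n)) v
  ... | before v< = begin
      suf (3 + n) v * ℓ (4 + n) (f (2 + n) + v)
        ≡⟨ cong (suf (3 + n) v *_) weight ⟩
      suf (3 + n) v * (a (2 + n) * ℓ (3 + n) v)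
        ≤⟨ *-≤-absorb (suf (3 + n) v) (ℓ (3 + n) v) (a (3 + n)) (2 ^ (1 + n)) (suffix₂ v v≤) (a-≥-· (1 + n)) ⟩
      2 ^ (1 + n) * a (4 + n) ∎
    where
      weight : ℓ (4 + n) (f (2 + n) + v) ≡ a (2 + n) * ℓ (3 + n) v
      weight = trans (ℓ-before (3 + n) (+-monoʳ-< (f (2 + n)) v<))
                     (trans (ℓ-from n v) (cong (a (2 + n) *_) (sym (ℓ-before₂ (1 + n) v<))))
  ... | from u = begin
      suf (3 + n) (f (1 + n) + u) * ℓ (4 + n) (f (2 + n) + (f (1 + n) + u))
        ≡⟨ cong (λ w → suf (3 + n) (f (1 + n) + u) * ℓ (4 + n) w) (f-+-assoc (1 + n) u) ⟨
      suf (3 + n) (f (1 + n) + u) * ℓ (4 + n) (f (3 + n) + u)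
        ≡⟨ cong (suf (3 + n) (f (1 + n) + u) *_) (ℓ-from (1 + n) u) ⟩
      suf (3 + n) (f (1 + n) + u) * (a (3 + n) * ℓ (2 + n) u)
        ≤⟨ *-≤-absorb (suf (3 + n) (f (1 + n) + u)) (ℓ (2 + n) u) (a (2 + n)) (2 ^ (1 + n))
                      (shifted-suffix₂ u (m+n≤o+m⇒n≤o (f (1 + n)) v≤)) (a-≥-·′ (1 + n)) ⟩
      2 ^ (1 + n) * a (4 + n) ∎

  shifted-suffix : ShiftedSuffixBound (5 + n)
  shifted-suffix j j≤ with cut (f (2 + n)) j
  ... | before j< = begin
      suf (5 + n) (f (3 + n) + j) * ℓ (4 + n) j
        ≤⟨ *-distribʳ-≤ (ℓ (4 + n) j) (suf (4 + n) (f (3 + n) + j) * a (3 + n)) (suf (4 + n) j)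
                        (suf-split-middle (2 + n) (<⇒≤ j<)) ⟩
      suf (4 + n) (f (3 + n) + j) * a (3 + n) * ℓ (4 + n) j + suf (4 + n) j * ℓ (4 + n) j
        ≤⟨ +-≤-double (2 ^ (2 + n)) (a (4 + n)) first (suffix₁ j j≤) ⟩
      2 ^ (3 + n) * a (4 + n) ∎
    where
      z≤ : f (3 + n) + j ≤ f (4 + n)
      z≤ = +-monoʳ-≤ (f (3 + n)) (<⇒≤ j<)
      first : suf (4 + n) (f (3 + n) + j) * a (3 + n) * ℓ (4 + n) j ≤ 2 ^ (2 + n) * a (4 + n)
      first = begin
        suf (4 + n) (f (3 + n) + j) * a (3 + n) * ℓ (4 + n) j
          ≡⟨ *-assoc (suf (4 + n) (f (3 + n) + j)) _ _ ⟩
        suf (4 + n) (f (3 + n) + j) * (a (3 + n) * ℓ (4 + n) j)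
          ≡⟨ cong (λ w → suf (4 + n) (f (3 + n) + j) * (a (3 + n) * w)) (ℓ-before₂ (2 + n) j<) ⟩
        suf (4 + n) (f (3 + n) + j) * (a (3 + n) * ℓ (2 + n) j)
          ≡⟨ cong (suf (4 + n) (f (3 + n) + j) *_) (ℓ-from (1 + n) j) ⟨
        suf (4 + n) (f (3 + n) + j) * ℓ (4 + n) (f (3 + n) + j)
          ≤⟨ suffix₁ _ z≤ ⟩
        2 ^ (2 + n) * a (4 + n) ∎
  ... | from v = begin
      suf (5 + n) (f (3 + n) + (f (2 + n) + v)) * ℓ (4 + n) (f (2 + n) + v)
        ≡⟨ cong (λ k → suf (5 + n) k * ℓ (4 + n) (f (2 + n) + v)) (f-+-assoc (2 + n) v) ⟨
      suf (5 + n) (f (4 + n) + v) * ℓ (4 + n) (f (2 + n) + v)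
        ≤⟨ *-distribʳ-≤ (ℓ (4 + n) (f (2 + n) + v)) (suf (3 + n) v) (suf (4 + n) (f (2 + n) + v))
                        (suf-split-long (2 + n) v) ⟩
      suf (3 + n) v * ℓ (4 + n) (f (2 + n) + v) + suf (4 + n) (f (2 + n) + v) * ℓ (4 + n) (f (2 + n) + v)
        ≤⟨ +-≤-double (2 ^ (2 + n)) (a (4 + n))
             (≤-trans (shifted-suffix-first v (m+n≤o+m⇒n≤o (f (2 + n)) j≤)) (*-≤-double (2 ^ (1 + n)) _))
             (suffix₁ _ j≤) ⟩
      2 ^ (3 + n) * a (4 + n) ∎

  next : Bounds (5 + n)
  next = record { prefix = prefix ; suffix = suffix ; shifted-prefix = shifted-prefix ; shifted-suffix = shifted-suffix }

by-computation : {Q : ℕ → Set} (Q? : Decidable Q) (b : ℕ) {_ : True (allUpTo? Q? (suc b))} → ∀ k → k ≤ b → Q k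
by-computation Q? b {checked} k k≤b = toWitness checked (s≤s k≤b)

opaque
  unfolding a pre suf

  bounds-3 : Bounds 3
  bounds-3 = record
    { prefix         = by-computation (λ k → pre 3 k ≤? 2 * ℓ 3 k) (f 3)
    ; suffix         = by-computation (λ k → suf 3 k * ℓ 3 k ≤? 2 * a 3) (f 3)
    ; shifted-prefix = by-computation (λ j → a 2 * pre 3 (f 1 + j) ≤? 2 * (a 3 * ℓ 2 j)) (f 2)
    ; shifted-suffix = by-computation (λ j → suf 3 (f 1 + j) * ℓ 2 j ≤? 2 * a 2) (f 2)
    }

  bounds-4 : Bounds 4
  bounds-4 = record
    { prefix         = by-computation (λ k → pre 4 k ≤? 4 * ℓ 4 k) (f 4)
    ; suffix         = by-computation (λ k → suf 4 k * ℓ 4 k ≤? 4 * a 4) (f 4)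
    ; shifted-prefix = by-computation (λ j → a 3 * pre 4 (f 2 + j) ≤? 4 * (a 4 * ℓ 3 j)) (f 3)
    ; shifted-suffix = by-computation (λ j → suf 4 (f 2 + j) * ℓ 3 j ≤? 4 * a 3) (f 3)
    }

bounds : ∀ n → Bounds (3 + n)
bounds zero = bounds-3
bounds (suc zero) = bounds-4
bounds (suc (suc n)) = Step.next n (bounds (suc n)) (bounds n)

4^n≡2^n*2^n : ∀ n → 4 ^ n ≡ 2 ^ n * 2 ^ n
4^n≡2^n*2^n zero = refl
4^n≡2^n*2^n (suc n) = trans (cong (4 *_) (4^n≡2^n*2^n n)) (sym ([m*n]*[o*p]≡[m*o]*[n*p] 2 (2 ^ n) 2 (2 ^ n)))

prefix-suffix-bound : ∀ n k → k ≤ f (3 + n) → pre (3 + n) k * suf (3 + n) k ≤ 4 ^ (1 + n) * a (3 + n)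
prefix-suffix-bound n k k≤ = begin
  pre (3 + n) k * suf (3 + n) k
    ≤⟨ *-≤-product (2 ^ (1 + n)) (Bounds.prefix (bounds n) k k≤) (Bounds.suffix (bounds n) k k≤) ⟩
  2 ^ (1 + n) * 2 ^ (1 + n) * a (3 + n)
    ≡⟨ cong (_* a (3 + n)) (4^n≡2^n*2^n (1 + n)) ⟨
  4 ^ (1 + n) * a (3 + n) ∎
  where open ≤-Reasoning

opaque
  unfolding a pre suf

  proposition9 : (n k : ℕ) → 3 ≤ n → 1 ≤ k → k ≤ f n ∸ 1 →
    card (prefixes k (A n)) * card (suffixes k (A n)) ≤ 4 ^ (n ∸ 2) * card (A n)
  proposition9 1 _ (s≤s ()) _ _
  proposition9 2 _ (s≤s (s≤s ())) _ _
  proposition9 (suc (suc (suc n))) k _ _ k≤ = prefix-suffix-bound n k (≤-trans k≤ (m∸n≤m (f (3 + n)) 1))
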